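{- Let $1\leq n<m$. Then $$C_{M_{2n+1},M_{2n+1}}(z) = z^{F_{2n+1}-1} + \sum_{i=0}^{n-1} z^{F_{2(n-i)}-1},$$ $$C_{M_{2n+2},M_{2n+2}}(z) = z^{F_{2n+2}-1} + \sum_{i=0}^{n} z^{F_{2(n-i)+1}-1},$$ $$C_{M_{2n+1},M_{2m+1}}(z) = C_{M_{2m+1},M_{2n+1}}(z) = \sum_{i=0}^{n-1} z^{F_{2(n-i)}-1},$$ $$C_{M_{2n+2},M_{2m+2}}(z) = C_{M_{2m+2},M_{2n+2}}(z) = \sum_{i=0}^{n} z^{F_{2(n-i)+1}-1},$$ $$C_{M_{2n+1},M_{2m+2}}(z) = C_{M_{2m+2},M_{2n+1}}(z) = 0,$$ $$C_{M_{2m+1},M_{2n+2}}(z) = C_{M_{2n+2},M_{2m+1}}(z) = 0.$$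
   Context: Fibonacci numbers: $F_1=F_2=1$, $F_n=F_{n-1}+F_{n-2}$. Finite Fibonacci words: $f_1=1$, $f_2=0$, $f_{n+2}=f_{n+1}f_n$ (so $|f_n|=F_n$). For $n\geq 3$, $p_n$ is $f_n$ with its last two letters deleted. The minimal forbidden factors of the infinite Fibonacci word are $M_{2n+1}=1p_{2n+1}1$ and $M_{2n+2}=0p_{2n+2}0$ for $n\geq 1$ (so $|M_n|=F_n$; e.g. $M_3=11$, $M_4=000$, $M_5=10101$, $M_6=00100100$). Words are indexed from $0$. For $u$ of length $n$ and $v$ of length $m$, the correlation $C_{u,v}$ is the binary word of length $n$ with $C_{u,v}[k]=1$ iff $u[i]=v[j]$ for all $0\le i<n$, $0\le j<m$ with $i=j+k$ (and $0$ otherwise); its correlation polynomial is $C_{u,v}(z)=\sum_{k=0}^{n-1}C_{u,v}[k]z^{n-1-k}$. -}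

module Defs where

open import Data.Nat using (ℕ; zero; suc; _+_; _*_; _∸_; _<ᵇ_; _≡ᵇ_; _%_)
open import Data.Bool using (Bool; true; false; not; _∨_; if_then_else_)
open import Data.List using (List; []; _∷_; _++_; length; reverse; drop; upTo; [_])
open import Relation.Binary.PropositionalEquality using (_≡_)

F : ℕ → ℕ
F zero = 0
F (suc zero) = 1
F (suc (suc n)) = F (suc n) + F n

-- Words over the alphabet {0,1}, letters represented by the naturals 0 and 1.
Word : Set
Word = List ℕ

-- Finite Fibonacci words: f 1 = 1, f 2 = 0, f (n+2) = f (n+1) f n.
-- (f 0 is an unused dummy value.)
f : ℕ → Word
f zero = []
f (suc zero) = [ 1 ]
f (suc (suc zero)) = [ 0 ]
f (suc (suc (suc n))) = f (suc (suc n)) ++ f (suc n)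

-- p n = f n with its last two letters deleted (used for n ≥ 3).
p : ℕ → Word
p n = reverse (drop 2 (reverse (f n)))

-- Minimal forbidden factors: M n = 1 p_n 1 for odd n, 0 p_n 0 for even n
-- (used for n ≥ 3: M (2k+1) = 1 p_{2k+1} 1, M (2k+2) = 0 p_{2k+2} 0, k ≥ 1).
M : ℕ → Word
M n = if n % 2 ≡ᵇ 1 then 1 ∷ (p n ++ [ 1 ]) else 0 ∷ (p n ++ [ 0 ])

-- Letter at position i (0-indexed); default 0 out of range (never used
-- out of range below, since all accesses are guarded by bounds).
at : Word → ℕ → ℕ
at [] _ = 0
at (x ∷ xs) zero = x
at (x ∷ xs) (suc i) = at xs i

allᵇ : (ℕ → Bool) → List ℕ → Bool
allᵇ P [] = true
allᵇ P (x ∷ xs) = if P x then allᵇ P xs else false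

-- C_{u,v}[k] = 1 iff u[i] = v[j] for all 0 ≤ i < |u|, 0 ≤ j < |v| with i = j + k.
-- (Quantifying over j < |v| and setting i = j + k, guarded by i < |u|.)
corrBit : Word → Word → ℕ → Bool
corrBit u v k =
  allᵇ (λ j → not (j + k <ᵇ length u) ∨ (at u (j + k) ≡ᵇ at v j)) (upTo (length v))

corr : Word → Word → List Bool
corr u v = Data.List.map (corrBit u v) (upTo (length u))

-- Polynomials with natural coefficients, as coefficient functions
-- (coefficient of z^e), compared pointwise.
Poly : Set
Poly = ℕ → ℕ

_≋_ : Poly → Poly → Set
P ≋ Q = ∀ e → P e ≡ Q e

infix 4 _≋_

0ₚ : Poly
0ₚ _ = 0

z^ : ℕ → Poly
z^ a e = if a ≡ᵇ e then 1 else 0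

_+ₚ_ : Poly → Poly → Poly
(P +ₚ Q) e = P e + Q e

infixl 6 _+ₚ_

Σₚ : ℕ → (ℕ → Poly) → Poly
Σₚ zero P = 0ₚ
Σₚ (suc n) P = Σₚ n P +ₚ P n

corrPoly : Word → Word → Poly
corrPoly u v = Σₚ (length u) (λ k → if corrBit u v k then z^ (length u ∸ 1 ∸ k) else 0ₚ)

-- Write φ for the Fibonacci morphism 0 ↦ 01, 1 ↦ 0. The coefficient of z^e in C_{u,v}
-- is 1 exactly when u has a suffix of length e + 1 compatible with v (one of the two is
-- a prefix of the other). The minimal forbidden factors are linked by φ:
-- M_{2n+2} = φ(M_{2n+1} 1) and 0 M_{2n+3} = φ(M_{2n+2}). Since {01, 0} is a prefix code,
-- the nonempty compatible suffixes of the image pair are exactly the images s ↦ φ(s 1)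
-- (together with the single letter 0), respectively s ↦ φ(s) minus its leading 0, of
-- those of the preimage pair. The image of s has length |s| + #₀(s) ± 1, so keeping track
-- of lengths and numbers of zeros turns lengths F_i into F_{i+1}. Starting from M_3 = 11
-- this produces the lengths F_{2j} for odd and F_{2j+1} for even words; when the two
-- words have different parities there is no compatible suffix at the start and none
-- is ever created.

module Submission where

open import Defs
open import Data.Nat using (ℕ; zero; suc; pred; _+_; _*_; _∸_; _%_; _≡ᵇ_; _≤_; _<_; z≤n; s≤s; z<s)
open import Data.Nat.DivMod using ([m+kn]%n≡m%n; m*n%n≡0)
open import Data.Nat.Properties
open import Data.List using ([]; _∷_; _++_; [_]; length; reverse; take; drop; applyUpTo; initLast; _∷ʳ′_)
open import Data.List.Properties using (++-assoc; ++-identityʳ; length-++; ∷-injectiveʳ; ∷ʳ-injective; ∷ʳ-injectiveʳ; reverse-++; reverse-involutive; length-drop; take++drop≡id)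
open import Data.List.Relation.Unary.All using (All; []; _∷_)
open import Data.List.Relation.Unary.All.Properties using (++⁺; ++⁻ʳ)
open import Data.Product using (∃-syntax; _×_; _,_; proj₁; proj₂)
open import Data.Unit using (⊤; tt)
open import Data.Empty using (⊥-elim)
open import Data.Sum using (_⊎_; inj₁; inj₂)
open import Data.Bool using (Bool; true; false; T; not; _∨_; if_then_else_)
open import Relation.Nullary using (¬_)
open import Function using (case_of_; id; _∘_)
open import Relation.Unary using (∅; _∪_; _≐′_)
open import Relation.Binary.Definitions using (tri<; tri≈; tri>)
open import Relation.Binary.PropositionalEquality hiding ([_])

-- The Fibonacci morphism

φ : Word → Word
φ [] = []
φ (zero ∷ w) = 0 ∷ 1 ∷ φ w
φ (suc _ ∷ w) = 0 ∷ φ w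

zeros : Word → ℕ
zeros [] = 0
zeros (zero ∷ w) = suc (zeros w)
zeros (suc _ ∷ w) = zeros w

Binary : Word → Set
Binary = All (_≤ 1)

φ-++ : ∀ x y → φ (x ++ y) ≡ φ x ++ φ y
φ-++ [] y = refl
φ-++ (zero ∷ x) y = cong (λ w → 0 ∷ 1 ∷ w) (φ-++ x y)
φ-++ (suc _ ∷ x) y = cong (0 ∷_) (φ-++ x y)

length-φ : ∀ w → length (φ w) ≡ length w + zeros w
length-φ [] = refl
length-φ (zero ∷ w) = cong suc (trans (cong suc (length-φ w)) (sym (+-suc (length w) (zeros w))))
length-φ (suc _ ∷ w) = cong suc (length-φ w)

zeros-φ : ∀ w → zeros (φ w) ≡ length w
zeros-φ [] = refl
zeros-φ (zero ∷ w) = cong suc (zeros-φ w)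
zeros-φ (suc _ ∷ w) = cong suc (zeros-φ w)

φ-binary : ∀ w → Binary (φ w)
φ-binary [] = []
φ-binary (zero ∷ w) = z≤n ∷ s≤s z≤n ∷ φ-binary w
φ-binary (suc _ ∷ w) = z≤n ∷ φ-binary w

φ-∷ : ∀ a w → ∃[ r ] φ (a ∷ w) ≡ 0 ∷ r
φ-∷ zero w = 1 ∷ φ w , refl
φ-∷ (suc _) w = φ w , refl

φ-∷ʳ : ∀ w a → ∃[ r ] φ (w ++ [ a ]) ≡ 0 ∷ r
φ-∷ʳ [] a = φ-∷ a []
φ-∷ʳ (b ∷ w) a = φ-∷ b (w ++ [ a ])

φ≡∷⇒≢[] : ∀ {x a r} → φ x ≡ a ∷ r → x ≢ []
φ≡∷⇒≢[] {[]} () refl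

φ-nonempty : ∀ s → s ≢ [] → ∃[ r ] φ s ≡ 0 ∷ r
φ-nonempty [] s≢[] = ⊥-elim (s≢[] refl)
φ-nonempty (a ∷ s) _ = φ-∷ a s

-- Compatible words

Compatible : Word → Word → Set
Compatible [] t = ⊤
Compatible (a ∷ s) [] = ⊤
Compatible (a ∷ s) (b ∷ t) = a ≡ b × Compatible s t

compatible-[]ʳ : ∀ s → Compatible s []
compatible-[]ʳ [] = tt
compatible-[]ʳ (_ ∷ _) = tt

compatible-sym : ∀ s t → Compatible s t → Compatible t s
compatible-sym [] t _ = compatible-[]ʳ t
compatible-sym (_ ∷ _) [] _ = tt
compatible-sym (a ∷ s) (b ∷ t) (a≡b , c) = sym a≡b , compatible-sym s t c

φ-compatible : ∀ s t → Compatible s t → Compatible (φ s) (φ t)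
φ-compatible [] t _ = tt
φ-compatible (a ∷ s) [] _ = compatible-[]ʳ (φ (a ∷ s))
φ-compatible (zero ∷ s) (.zero ∷ t) (refl , c) = refl , refl , φ-compatible s t c
φ-compatible (suc a ∷ s) (.(suc a) ∷ t) (refl , c) = refl , φ-compatible s t c

φ-∷ʳ1-compatible : ∀ s t → Compatible s t → Compatible (φ (s ++ [ 1 ])) (φ (t ++ [ 1 ]))
φ-∷ʳ1-compatible [] t _ = subst (Compatible (φ [ 1 ])) (sym (proj₂ (φ-∷ʳ t 1))) (refl , tt)
φ-∷ʳ1-compatible (a ∷ s) [] _ =
  subst (λ w → Compatible w (φ [ 1 ])) (sym (proj₂ (φ-∷ʳ (a ∷ s) 1))) (refl , compatible-[]ʳ _)
φ-∷ʳ1-compatible (zero ∷ s) (.zero ∷ t) (refl , c) = refl , refl , φ-∷ʳ1-compatible s t c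
φ-∷ʳ1-compatible (suc a ∷ s) (.(suc a) ∷ t) (refl , c) = refl , φ-∷ʳ1-compatible s t c

1≁φ∷ʳ : ∀ w a r → ¬ Compatible (1 ∷ r) (φ (w ++ [ a ]))
1≁φ∷ʳ w a r c = 1+n≢0 (proj₁ (subst (Compatible (1 ∷ r)) (proj₂ (φ-∷ʳ w a)) c))

φ∷ʳ≁1 : ∀ w a r → ¬ Compatible (φ (w ++ [ a ])) (1 ∷ r)
φ∷ʳ≁1 w a r c = 1≁φ∷ʳ w a r (compatible-sym (φ (w ++ [ a ])) (1 ∷ r) c)

-- Compatible (φ s) (φ t) alone does not give Compatible s t, since φ 0 = 01 and φ 1 = 0 are
-- comparable; the appended last letters rule out a mismatch hidden at the end.
φ-∷ʳ1-compatible⁻ : ∀ {s t} → Binary s → Binary t →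
  Compatible (φ (s ++ [ 1 ])) (φ (t ++ [ 1 ])) → Compatible s t
φ-∷ʳ1-compatible⁻ [] _ _ = tt
φ-∷ʳ1-compatible⁻ (_ ∷ _) [] _ = tt
φ-∷ʳ1-compatible⁻ (z≤n ∷ bs) (z≤n ∷ bt) (_ , _ , c) = refl , φ-∷ʳ1-compatible⁻ bs bt c
φ-∷ʳ1-compatible⁻ (s≤s z≤n ∷ bs) (s≤s z≤n ∷ bt) (_ , c) = refl , φ-∷ʳ1-compatible⁻ bs bt c
φ-∷ʳ1-compatible⁻ {_ ∷ s} {_ ∷ t} (z≤n ∷ _) (s≤s z≤n ∷ _) (_ , c) = ⊥-elim (1≁φ∷ʳ t 1 _ c)
φ-∷ʳ1-compatible⁻ {_ ∷ s} {_ ∷ t} (s≤s z≤n ∷ _) (z≤n ∷ _) (_ , c) = ⊥-elim (φ∷ʳ≁1 s 1 _ c)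

φ-∷ʳ0-compatible⁻ : ∀ {s t} → Binary s → Binary t →
  Compatible (φ (s ++ [ 0 ])) (φ (t ++ [ 0 ])) → Compatible (s ++ [ 0 ]) (t ++ [ 0 ])
φ-∷ʳ0-compatible⁻ [] [] _ = refl , tt
φ-∷ʳ0-compatible⁻ [] (z≤n ∷ _) _ = refl , tt
φ-∷ʳ0-compatible⁻ {t = _ ∷ t} [] (s≤s z≤n ∷ _) (_ , c) = ⊥-elim (1≁φ∷ʳ t 0 [] c)
φ-∷ʳ0-compatible⁻ {s = _ ∷ s} (z≤n ∷ _) [] _ = refl , compatible-[]ʳ (s ++ [ 0 ])
φ-∷ʳ0-compatible⁻ {s = _ ∷ s} (s≤s z≤n ∷ _) [] (_ , c) = ⊥-elim (φ∷ʳ≁1 s 0 [] c)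
φ-∷ʳ0-compatible⁻ (z≤n ∷ bs) (z≤n ∷ bt) (_ , _ , c) = refl , φ-∷ʳ0-compatible⁻ bs bt c
φ-∷ʳ0-compatible⁻ (s≤s z≤n ∷ bs) (s≤s z≤n ∷ bt) (_ , c) = refl , φ-∷ʳ0-compatible⁻ bs bt c
φ-∷ʳ0-compatible⁻ {_ ∷ s} {_ ∷ t} (z≤n ∷ _) (s≤s z≤n ∷ _) (_ , c) = ⊥-elim (1≁φ∷ʳ t 0 _ c)
φ-∷ʳ0-compatible⁻ {_ ∷ s} {_ ∷ t} (s≤s z≤n ∷ _) (z≤n ∷ _) (_ , c) = ⊥-elim (φ∷ʳ≁1 s 0 _ c)

φ-∷ʳ01-compatible⁻ : ∀ {s t} → Binary s → Binary t →
  Compatible (φ (s ++ [ 0 ])) (φ (t ++ [ 1 ])) → Compatible (s ++ [ 0 ]) t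
φ-∷ʳ01-compatible⁻ [] [] _ = tt
φ-∷ʳ01-compatible⁻ [] (z≤n ∷ _) _ = refl , tt
φ-∷ʳ01-compatible⁻ {t = _ ∷ t} [] (s≤s z≤n ∷ _) (_ , c) = ⊥-elim (1≁φ∷ʳ t 1 [] c)
φ-∷ʳ01-compatible⁻ (_ ∷ _) [] _ = tt
φ-∷ʳ01-compatible⁻ (z≤n ∷ bs) (z≤n ∷ bt) (_ , _ , c) = refl , φ-∷ʳ01-compatible⁻ bs bt c
φ-∷ʳ01-compatible⁻ (s≤s z≤n ∷ bs) (s≤s z≤n ∷ bt) (_ , c) = refl , φ-∷ʳ01-compatible⁻ bs bt c
φ-∷ʳ01-compatible⁻ {_ ∷ s} {_ ∷ t} (z≤n ∷ _) (s≤s z≤n ∷ _) (_ , c) = ⊥-elim (1≁φ∷ʳ t 1 _ c)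
φ-∷ʳ01-compatible⁻ {_ ∷ s} {_ ∷ t} (s≤s z≤n ∷ _) (z≤n ∷ _) (_ , c) = ⊥-elim (φ∷ʳ≁1 s 0 _ c)

infix 4 _IsSuffixOf_

_IsSuffixOf_ : Word → Word → Set
s IsSuffixOf u = ∃[ pre ] pre ++ s ≡ u

suffix-refl : ∀ u → u IsSuffixOf u
suffix-refl u = [] , refl

suffix-[] : ∀ u → [] IsSuffixOf u
suffix-[] u = u , ++-identityʳ u

suffix-∷ : ∀ a {s u} → s IsSuffixOf u → s IsSuffixOf (a ∷ u)
suffix-∷ a (pre , refl) = a ∷ pre , refl

suffix-∷⁻ : ∀ {a b s u} → (a ∷ s) IsSuffixOf (b ∷ u) → s IsSuffixOf u
suffix-∷⁻ ([] , refl) = [] , refl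
suffix-∷⁻ {a} {s = s} (c ∷ pre , refl) = pre ++ [ a ] , ++-assoc pre [ a ] s

suffix-++ʳ : ∀ {s u} t → s IsSuffixOf u → (s ++ t) IsSuffixOf (u ++ t)
suffix-++ʳ {s} t (pre , refl) = pre , sym (++-assoc pre s t)

suffix-φ : ∀ {s u} → s IsSuffixOf u → φ s IsSuffixOf φ u
suffix-φ {s} (pre , refl) = φ pre , sym (φ-++ pre s)

suffix-binary : ∀ {s u} → s IsSuffixOf u → Binary u → Binary s
suffix-binary (pre , refl) b = ++⁻ʳ pre b

suffix-∷ʳ⁻ : ∀ {s} w a → s IsSuffixOf (w ++ [ a ]) → s ≢ [] → ∃[ t ] s ≡ t ++ [ a ] × t IsSuffixOf w
suffix-∷ʳ⁻ {s} w a (pre , e) s≢[] with initLast s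
... | [] = ⊥-elim (s≢[] refl)
... | t ∷ʳ′ b with ∷ʳ-injective (pre ++ t) w (trans (++-assoc pre t [ b ]) e)
...   | pre++t≡w , refl = t , refl , pre , pre++t≡w

φ≢1∷ : ∀ w {r} → φ w ≢ 1 ∷ r
φ≢1∷ [] ()
φ≢1∷ (zero ∷ w) ()
φ≢1∷ (suc _ ∷ w) ()

suffix-φ⁻ : ∀ w {r} → (0 ∷ r) IsSuffixOf φ w → ∃[ x ] x IsSuffixOf w × φ x ≡ 0 ∷ r
suffix-φ⁻ [] ([] , ())
suffix-φ⁻ [] (_ ∷ _ , ())
suffix-φ⁻ (a ∷ w) ([] , e) = a ∷ w , suffix-refl _ , sym e
suffix-φ⁻ (zero ∷ w) (_ ∷ [] , ())
suffix-φ⁻ (zero ∷ w) (_ ∷ _ ∷ pre , e) with suffix-φ⁻ w (pre , ∷-injectiveʳ (∷-injectiveʳ e))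
... | x , x⊑w , φx = x , suffix-∷ 0 x⊑w , φx
suffix-φ⁻ (suc _ ∷ w) (_ ∷ pre , e) with suffix-φ⁻ w (pre , ∷-injectiveʳ e)
... | x , x⊑w , φx = x , suffix-∷ _ x⊑w , φx

suffix-φ-1 : ∀ w {r} → (1 ∷ r) IsSuffixOf φ w → (0 ∷ 1 ∷ r) IsSuffixOf φ w
suffix-φ-1 [] ([] , ())
suffix-φ-1 [] (_ ∷ _ , ())
suffix-φ-1 (zero ∷ w) ([] , ())
suffix-φ-1 (zero ∷ w) (_ ∷ [] , refl) = suffix-refl _
suffix-φ-1 (zero ∷ w) (_ ∷ _ ∷ pre , e) =
  suffix-∷ 0 (suffix-∷ 1 (suffix-φ-1 w (pre , ∷-injectiveʳ (∷-injectiveʳ e))))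
suffix-φ-1 (suc _ ∷ w) ([] , ())
suffix-φ-1 (suc _ ∷ w) (_ ∷ pre , e) = suffix-∷ 0 (suffix-φ-1 w (pre , ∷-injectiveʳ e))

11-not-suffix-φ : ∀ w {r} → ¬ (1 ∷ 1 ∷ r) IsSuffixOf φ w
11-not-suffix-φ [] ([] , ())
11-not-suffix-φ [] (_ ∷ _ , ())
11-not-suffix-φ (zero ∷ w) ([] , ())
11-not-suffix-φ (zero ∷ w) (_ ∷ [] , e) = φ≢1∷ w (sym (∷-injectiveʳ (∷-injectiveʳ e)))
11-not-suffix-φ (zero ∷ w) (_ ∷ _ ∷ pre , e) = 11-not-suffix-φ w (pre , ∷-injectiveʳ (∷-injectiveʳ e))
11-not-suffix-φ (suc _ ∷ w) ([] , ())
11-not-suffix-φ (suc _ ∷ w) (_ ∷ pre , e) = 11-not-suffix-φ w (pre , ∷-injectiveʳ e)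

F-pos : ∀ i → 1 ≤ F (suc i)
F-pos zero = s≤s z≤n
F-pos (suc i) = ≤-trans (F-pos i) (m≤m+n (F (suc i)) (F i))

F-pos′ : ∀ {i} → 1 ≤ i → 1 ≤ F i
F-pos′ {suc i} _ = F-pos i

F-mono-suc : ∀ i → F i ≤ F (suc i)
F-mono-suc zero = z≤n
F-mono-suc (suc zero) = ≤-refl
F-mono-suc (suc (suc i)) = m≤m+n (F (suc (suc i))) (F (suc i))

F-strict : ∀ {a b} → 2 ≤ a → a < b → F a < F b
F-strict {suc zero} (s≤s ()) _
F-strict {suc (suc a)} {suc b} 2≤a (s≤s a≤b) with m≤n⇒m<n∨m≡n a≤b
... | inj₁ a<b = <-≤-trans (F-strict 2≤a a<b) (F-mono-suc b)
... | inj₂ refl = m<m+n (F (suc (suc a))) (F-pos a)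

F-strict₁ : ∀ {a b} → 1 ≤ a → a < b → 3 ≤ b → F a < F b
F-strict₁ {suc zero} _ _ 3≤b = F-strict ≤-refl 3≤b
F-strict₁ {suc (suc a)} _ a<b _ = F-strict (s≤s (s≤s z≤n)) a<b

strictlyMonotone⇒injective : ∀ {g : ℕ → ℕ} {P : ℕ → Set} →
  (∀ {a b} → P a → P b → a < b → g a < g b) → ∀ {a b} → P a → P b → g a ≡ g b → a ≡ b
strictlyMonotone⇒injective mono {a} {b} pa pb ga≡gb with <-cmp a b
... | tri< a<b _ _ = ⊥-elim (<-irrefl ga≡gb (mono pa pb a<b))
... | tri≈ _ a≡b _ = a≡b
... | tri> _ _ b<a = ⊥-elim (<-irrefl (sym ga≡gb) (mono pb pa b<a))

2≤2* : ∀ {j} → 1 ≤ j → 2 ≤ 2 * j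
2≤2* 1≤j = *-monoʳ-≤ 2 1≤j

1≤2*+1 : ∀ j → 1 ≤ 2 * j + 1
1≤2*+1 j = m≤n+m 1 (2 * j)

F-even-strict : ∀ {a b} → 1 ≤ a → a < b → F (2 * a) < F (2 * b)
F-even-strict 1≤a a<b = F-strict (2≤2* 1≤a) (*-monoʳ-< 2 a<b)

F-odd-strict : ∀ {a b} → a < b → F (2 * a + 1) < F (2 * b + 1)
F-odd-strict {a} a<b =
  F-strict₁ (1≤2*+1 a) (+-monoˡ-< 1 (*-monoʳ-< 2 a<b)) (+-monoˡ-≤ 1 (2≤2* (≤-trans (s≤s z≤n) a<b)))

∸1≡⇒ : ∀ {x e} → 1 ≤ x → x ∸ 1 ≡ e → x ≡ suc e
∸1≡⇒ {suc x} _ eq = cong suc eq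

∸1-injective : ∀ {x y} → 1 ≤ x → 1 ≤ y → x ∸ 1 ≡ y ∸ 1 → x ≡ y
∸1-injective {suc x} {suc y} _ _ eq = cong suc eq

-- Indicator polynomials

infix 4 _IndicatorOf_

_IndicatorOf_ : Poly → (ℕ → Set) → Set
P IndicatorOf Q = ∀ e → (P e ≡ 1 × Q e) ⊎ (P e ≡ 0 × ¬ Q e)

indicator-resp : ∀ {P Q Q'} → Q ≐′ Q' → P IndicatorOf Q → P IndicatorOf Q'
indicator-resp (Q⊆Q' , Q'⊆Q) ind e with ind e
... | inj₁ (Pe≡1 , q) = inj₁ (Pe≡1 , Q⊆Q' e q)
... | inj₂ (Pe≡0 , ¬q) = inj₂ (Pe≡0 , ¬q ∘ Q'⊆Q e)

indicator-≋ : ∀ {P P' Q} → P IndicatorOf Q → P' IndicatorOf Q → P ≋ P'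
indicator-≋ ind ind' e with ind e | ind' e
... | inj₁ (Pe≡1 , _) | inj₁ (P'e≡1 , _) = trans Pe≡1 (sym P'e≡1)
... | inj₁ (_ , q) | inj₂ (_ , ¬q) = ⊥-elim (¬q q)
... | inj₂ (_ , ¬q) | inj₁ (_ , q) = ⊥-elim (¬q q)
... | inj₂ (Pe≡0 , _) | inj₂ (P'e≡0 , _) = trans Pe≡0 (sym P'e≡0)

indicator-0ₚ : 0ₚ IndicatorOf ∅
indicator-0ₚ e = inj₂ (refl , λ ())

indicator-z^ : ∀ a → z^ a IndicatorOf (a ≡_)
indicator-z^ a e with a ≡ᵇ e in a≡ᵇe
... | true = inj₁ (refl , ≡ᵇ⇒≡ a e (subst T (sym a≡ᵇe) tt))
... | false = inj₂ (refl , λ a≡e → subst T a≡ᵇe (≡⇒≡ᵇ a e a≡e))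

indicator-if : ∀ b {P Q} → P IndicatorOf Q → (if b then P else 0ₚ) IndicatorOf (λ e → T b × Q e)
indicator-if false _ e = inj₂ (refl , proj₁)
indicator-if true ind e with ind e
... | inj₁ (Pe≡1 , q) = inj₁ (Pe≡1 , tt , q)
... | inj₂ (Pe≡0 , ¬q) = inj₂ (Pe≡0 , ¬q ∘ proj₂)

indicator-+ₚ : ∀ {P P' Q Q'} → (∀ e → Q e → ¬ Q' e) →
  P IndicatorOf Q → P' IndicatorOf Q' → P +ₚ P' IndicatorOf Q ∪ Q'
indicator-+ₚ disjoint ind ind' e with ind e | ind' e
... | inj₁ (_ , q) | inj₁ (_ , q') = ⊥-elim (disjoint e q q')
... | inj₁ (Pe≡1 , q) | inj₂ (P'e≡0 , _) = inj₁ (cong₂ _+_ Pe≡1 P'e≡0 , inj₁ q)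
... | inj₂ (Pe≡0 , _) | inj₁ (P'e≡1 , q') = inj₁ (cong₂ _+_ Pe≡0 P'e≡1 , inj₂ q')
... | inj₂ (Pe≡0 , ¬q) | inj₂ (P'e≡0 , ¬q') =
  inj₂ (cong₂ _+_ Pe≡0 P'e≡0 , λ { (inj₁ q) → ¬q q ; (inj₂ q') → ¬q' q' })

indicator-Σₚ : ∀ N {g : ℕ → Poly} {Q : ℕ → ℕ → Set} →
  (∀ k → g k IndicatorOf Q k) → (∀ {k k' e} → k < N → k' < N → Q k e → Q k' e → k ≡ k') →
  Σₚ N g IndicatorOf (λ e → ∃[ k ] k < N × Q k e)
indicator-Σₚ zero _ _ = indicator-resp ((λ _ ()) , λ { _ (_ , () , _) }) indicator-0ₚ
indicator-Σₚ (suc N) {g} {Q} ind unique =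
  indicator-resp (fromUnion , toUnion)
    (indicator-+ₚ disjoint (indicator-Σₚ N ind λ k<N k'<N → unique (m<n⇒m<1+n k<N) (m<n⇒m<1+n k'<N)) (ind N))
  where
  disjoint : ∀ e → (∃[ k ] k < N × Q k e) → ¬ Q N e
  disjoint e (k , k<N , q) q' = <-irrefl (unique (m<n⇒m<1+n k<N) ≤-refl q q') k<N
  fromUnion : ∀ e → (∃[ k ] k < N × Q k e) ⊎ Q N e → ∃[ k ] k < suc N × Q k e
  fromUnion e (inj₁ (k , k<N , q)) = k , m<n⇒m<1+n k<N , q
  fromUnion e (inj₂ q) = N , ≤-refl , q
  toUnion : ∀ e → (∃[ k ] k < suc N × Q k e) → (∃[ k ] k < N × Q k e) ⊎ Q N e
  toUnion e (k , s≤s k≤N , q) with m≤n⇒m<n∨m≡n k≤N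
  ... | inj₁ k<N = inj₁ (k , k<N , q)
  ... | inj₂ refl = inj₂ q

T-allᵇ : ∀ P f n → T (allᵇ P (applyUpTo f n)) → ∀ j → j < n → T (P (f j))
T-allᵇ P f (suc n) h j j<n with P (f 0) in P0
T-allᵇ P f (suc n) h zero _ | true = subst T (sym P0) tt
T-allᵇ P f (suc n) h (suc j) (s≤s j<n) | true = T-allᵇ P (f ∘ suc) n h j j<n

T-allᵇ⁻ : ∀ P f n → (∀ j → j < n → T (P (f j))) → T (allᵇ P (applyUpTo f n))
T-allᵇ⁻ P f zero _ = tt
T-allᵇ⁻ P f (suc n) h with P (f 0) | h 0 z<s
... | true | _ = T-allᵇ⁻ P (f ∘ suc) n (λ j j<n → h (suc j) (s≤s j<n))

T-not-∨ : ∀ {b c} → T (not b ∨ c) → T b → T c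
T-not-∨ {true} h _ = h

T-not-∨⁻ : ∀ {b c} → (T b → T c) → T (not b ∨ c)
T-not-∨⁻ {true} h = h tt
T-not-∨⁻ {false} _ = tt

compatible⇒at : ∀ s t → Compatible s t → ∀ j → j < length s → j < length t → at s j ≡ at t j
compatible⇒at (a ∷ s) (b ∷ t) (a≡b , _) zero _ _ = a≡b
compatible⇒at (a ∷ s) (b ∷ t) (_ , c) (suc j) (s≤s j<s) (s≤s j<t) = compatible⇒at s t c j j<s j<t

at⇒compatible : ∀ s t → (∀ j → j < length s → j < length t → at s j ≡ at t j) → Compatible s t
at⇒compatible [] t _ = tt
at⇒compatible (a ∷ s) [] _ = tt
at⇒compatible (a ∷ s) (b ∷ t) agree =
  agree 0 z<s z<s , at⇒compatible s t (λ j j<s j<t → agree (suc j) (s≤s j<s) (s≤s j<t))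

at-drop : ∀ k u j → at (drop k u) j ≡ at u (j + k)
at-drop zero u j = cong (at u) (sym (+-identityʳ j))
at-drop (suc k) [] j = refl
at-drop (suc k) (x ∷ u) j = trans (at-drop k u j) (cong (at (x ∷ u)) (sym (+-suc j k)))

<-length-drop : ∀ k (u : Word) j → j < length (drop k u) → j + k < length u
<-length-drop zero u j j<u = subst (_< length u) (sym (+-identityʳ j)) j<u
<-length-drop (suc k) (x ∷ u) j j<u = subst (_< suc (length u)) (sym (+-suc j k)) (s≤s (<-length-drop k u j j<u))

<-length-drop⁻ : ∀ k (u : Word) j → j + k < length u → j < length (drop k u)
<-length-drop⁻ zero u j j<u = subst (_< length u) (+-identityʳ j) j<u
<-length-drop⁻ (suc k) (x ∷ u) j j<u = <-length-drop⁻ k u j (≤-pred (subst (_< suc (length u)) (+-suc j k) j<u))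

corrBit⇒compatible : ∀ u v k → T (corrBit u v k) → Compatible (drop k u) v
corrBit⇒compatible u v k h = at⇒compatible (drop k u) v agree
  where
  agree : ∀ j → j < length (drop k u) → j < length v → at (drop k u) j ≡ at v j
  agree j j<d j<v = trans (at-drop k u j)
    (≡ᵇ⇒≡ _ _ (T-not-∨ (T-allᵇ _ id (length v) h j j<v) (<⇒<ᵇ (<-length-drop k u j j<d))))

compatible⇒corrBit : ∀ u v k → Compatible (drop k u) v → T (corrBit u v k)
compatible⇒corrBit u v k c = T-allᵇ⁻ _ id (length v) λ j j<v → T-not-∨⁻ λ j+k<u →
  ≡⇒≡ᵇ _ _ (trans (sym (at-drop k u j))
    (compatible⇒at (drop k u) v c j (<-length-drop⁻ k u j (<ᵇ⇒< _ _ j+k<u)) j<v))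

Overlap : Word → Word → ℕ → Set
Overlap u v e = ∃[ s ] s IsSuffixOf u × Compatible s v × length s ≡ suc e

drop-length-++ : ∀ (pre s : Word) → drop (length pre) (pre ++ s) ≡ s
drop-length-++ [] s = refl
drop-length-++ (_ ∷ pre) s = drop-length-++ pre s

∸-suc : ∀ {N k} → k < N → N ∸ k ≡ suc (N ∸ 1 ∸ k)
∸-suc {suc N} (s≤s k≤N) = +-∸-assoc 1 k≤N

∸1-cancelˡ : ∀ {N k k'} → k < N → k' < N → N ∸ 1 ∸ k ≡ N ∸ 1 ∸ k' → k ≡ k'
∸1-cancelˡ {suc N} (s≤s k≤N) (s≤s k'≤N) = ∸-cancelˡ-≡ k≤N k'≤N

CorrExponent : Word → Word → ℕ → Set
CorrExponent u v e = ∃[ k ] k < length u × T (corrBit u v k) × length u ∸ 1 ∸ k ≡ e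

corrExponent⇒overlap : ∀ u v e → CorrExponent u v e → Overlap u v e
corrExponent⇒overlap u v e (k , k<u , c , eq) =
  drop k u , (take k u , take++drop≡id k u) , corrBit⇒compatible u v k c ,
  trans (length-drop k u) (trans (∸-suc k<u) (cong suc eq))

overlap⇒corrExponent : ∀ u v e → Overlap u v e → CorrExponent u v e
overlap⇒corrExponent .(pre ++ s) v e (s , (pre , refl) , c , len) =
  length pre , subst (length pre <_) (sym total) (s≤s (m≤m+n (length pre) e)) ,
  compatible⇒corrBit (pre ++ s) v (length pre) (subst (λ w → Compatible w v) (sym (drop-length-++ pre s)) c) ,
  trans (cong (λ x → x ∸ 1 ∸ length pre) total) (m+n∸m≡n (length pre) e)
  where
  total : length (pre ++ s) ≡ suc (length pre + e)
  total = trans (length-++ pre) (trans (cong (length pre +_) len) (+-suc (length pre) e))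

corrPoly-indicator : ∀ u v → corrPoly u v IndicatorOf Overlap u v
corrPoly-indicator u v =
  indicator-resp (corrExponent⇒overlap u v , overlap⇒corrExponent u v)
    (indicator-Σₚ (length u) (λ k → indicator-if (corrBit u v k) (indicator-z^ (length u ∸ 1 ∸ k)))
      λ k<u k'<u (_ , eq) (_ , eq') → ∸1-cancelˡ k<u k'<u (trans eq (sym eq')))

length≡suc⇒≢[] : ∀ {s : Word} {n} → length s ≡ suc n → s ≢ []
length≡suc⇒≢[] () refl

-- Compatible suffixes under the renormalisation steps

length≡F⇒≢[] : ∀ {s : Word} {i} → length s ≡ F (suc i) → s ≢ []
length≡F⇒≢[] {i = i} len refl with subst (1 ≤_) (sym len) (F-pos i)
... | ()

φ∷ʳ1-shape : ∀ s i → length s ≡ F (suc i) → suc (zeros s) ≡ F i →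
  length (φ (s ++ [ 1 ])) ≡ F (suc (suc i)) × zeros (φ (s ++ [ 1 ])) ≡ suc (F (suc i))
φ∷ʳ1-shape s i len zs = length-image , zeros-image
  where
  open ≡-Reasoning
  length-image : length (φ (s ++ [ 1 ])) ≡ F (suc (suc i))
  length-image = begin
    length (φ (s ++ [ 1 ]))    ≡⟨ cong length (φ-++ s [ 1 ]) ⟩
    length (φ s ++ [ 0 ])      ≡⟨ length-++ (φ s) ⟩
    length (φ s) + 1           ≡⟨ cong (_+ 1) (length-φ s) ⟩
    length s + zeros s + 1     ≡⟨ +-assoc (length s) (zeros s) 1 ⟩
    length s + (zeros s + 1)   ≡⟨ cong₂ _+_ len (trans (+-comm (zeros s) 1) zs) ⟩
    F (suc i) + F i            ∎
  zeros-image : zeros (φ (s ++ [ 1 ])) ≡ suc (F (suc i))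
  zeros-image = begin
    zeros (φ (s ++ [ 1 ]))     ≡⟨ zeros-φ (s ++ [ 1 ]) ⟩
    length (s ++ [ 1 ])        ≡⟨ length-++ s ⟩
    length s + 1               ≡⟨ +-comm (length s) 1 ⟩
    suc (length s)             ≡⟨ cong suc len ⟩
    suc (F (suc i))            ∎

φ-tail-shape : ∀ s s' i → φ s ≡ 0 ∷ s' → length s ≡ F (suc i) → zeros s ≡ suc (F i) →
  length s' ≡ F (suc (suc i)) × suc (zeros s') ≡ F (suc i)
φ-tail-shape s s' i φs len zs = suc-injective length-image , zeros-image
  where
  open ≡-Reasoning
  length-image : suc (length s') ≡ suc (F (suc (suc i)))
  length-image = begin
    suc (length s')            ≡⟨ cong length (sym φs) ⟩
    length (φ s)               ≡⟨ length-φ s ⟩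
    length s + zeros s         ≡⟨ cong₂ _+_ len zs ⟩
    F (suc i) + suc (F i)      ≡⟨ +-suc (F (suc i)) (F i) ⟩
    suc (F (suc (suc i)))      ∎
  zeros-image : suc (zeros s') ≡ F (suc i)
  zeros-image = trans (cong zeros (sym φs)) (trans (zeros-φ s) len)

-- EvenIdx n b (resp. OddIdx n b) indexes the lengths F i of the compatible suffixes of
-- M_{2n+1} (resp. M_{2n+2}); the flag b adds the whole word, compatible only in the
-- autocorrelation.
EvenIdx : ℕ → Bool → ℕ → Set
EvenIdx n b i = (∃[ j ] 1 ≤ j × j ≤ n × i ≡ 2 * j) ⊎ (b ≡ true × i ≡ 2 * n + 1)

OddIdx : ℕ → Bool → ℕ → Set
OddIdx n b i = (∃[ j ] j ≤ n × i ≡ 2 * j + 1) ⊎ (b ≡ true × i ≡ 2 * n + 2)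

evenIdx-nonzero : ∀ {n b i} → EvenIdx n b i → ∃[ i₀ ] i ≡ suc i₀
evenIdx-nonzero (inj₁ (suc j , _ , _ , refl)) = suc (2 * j) , *-suc 2 j
evenIdx-nonzero {n} (inj₂ (_ , refl)) = 2 * n , +-comm (2 * n) 1

oddIdx-nonzero : ∀ {n b i} → OddIdx n b i → ∃[ i₀ ] i ≡ suc i₀
oddIdx-nonzero (inj₁ (j , _ , refl)) = 2 * j , +-comm (2 * j) 1
oddIdx-nonzero {n} (inj₂ (_ , refl)) = suc (2 * n) , +-comm (2 * n) 2

evenIdx-shift : ∀ {n b i} → EvenIdx n b i → OddIdx n b (suc i)
evenIdx-shift (inj₁ (j , _ , j≤n , refl)) = inj₁ (j , j≤n , sym (+-comm (2 * j) 1))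
evenIdx-shift {n} (inj₂ (b≡true , refl)) =
  inj₂ (b≡true , trans (cong suc (+-comm (2 * n) 1)) (sym (+-comm (2 * n) 2)))

oddIdx-unshift : ∀ {n b i} → OddIdx n b i → i ≡ 1 ⊎ ∃[ i₀ ] EvenIdx n b i₀ × i ≡ suc i₀
oddIdx-unshift (inj₁ (zero , _ , refl)) = inj₁ refl
oddIdx-unshift (inj₁ (suc j , j≤n , refl)) =
  inj₂ (2 * suc j , inj₁ (suc j , s≤s z≤n , j≤n , refl) , +-comm (2 * suc j) 1)
oddIdx-unshift {n} (inj₂ (b≡true , refl)) =
  inj₂ (2 * n + 1 , inj₂ (b≡true , refl) , trans (+-comm (2 * n) 2) (cong suc (sym (+-comm (2 * n) 1))))

oddIdx-shift : ∀ {n b i} → OddIdx n b i → EvenIdx (suc n) b (suc i)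
oddIdx-shift (inj₁ (j , j≤n , refl)) =
  inj₁ (suc j , s≤s z≤n , s≤s j≤n , trans (cong suc (+-comm (2 * j) 1)) (sym (*-suc 2 j)))
oddIdx-shift {n} (inj₂ (b≡true , refl)) =
  inj₂ (b≡true , trans (cong suc (+-comm (2 * n) 2)) (sym (trans (+-comm (2 * suc n) 1) (cong suc (*-suc 2 n)))))

evenIdx-unshift : ∀ {n b i} → EvenIdx (suc n) b i → ∃[ i₀ ] OddIdx n b i₀ × i ≡ suc i₀
evenIdx-unshift (inj₁ (suc j , _ , s≤s j≤n , refl)) =
  2 * j + 1 , inj₁ (j , j≤n , refl) , trans (*-suc 2 j) (cong suc (sym (+-comm (2 * j) 1)))
evenIdx-unshift {n} (inj₂ (b≡true , refl)) =
  2 * n + 2 , inj₂ (b≡true , refl) , trans (+-comm (2 * suc n) 1) (cong suc (trans (*-suc 2 n) (sym (+-comm (2 * n) 2))))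

-- Z prescribes the number of zeros of the suffix of length F i; it determines the
-- length of the image of that suffix.
record CompatibleSuffixes (u v : Word) (I : ℕ → Set) (Z : ℕ → ℕ → Set) : Set where
  field
    lengths : ∀ s → s IsSuffixOf u → s ≢ [] → Compatible s v →
              ∃[ i ] I i × length s ≡ F i × Z i (zeros s)
    witness : ∀ i → I i →
              ∃[ s ] s IsSuffixOf u × Compatible s v × length s ≡ F i × Z i (zeros s)

OddInvariant : Word → Word → ℕ → Bool → Set
OddInvariant u v n b = CompatibleSuffixes u v (EvenIdx n b) (λ i z → suc z ≡ F (pred i))

EvenInvariant : Word → Word → ℕ → Bool → Set
EvenInvariant u v n b = CompatibleSuffixes u v (OddIdx n b) (λ i z → z ≡ suc (F (pred i)))

NoCompatibleSuffix : Word → Word → Set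
NoCompatibleSuffix u v = ∀ s → s IsSuffixOf u → s ≢ [] → ¬ Compatible s v

FibLength : (ℕ → Set) → ℕ → Set
FibLength I e = ∃[ i ] I i × F i ≡ suc e

invariant-indicator : ∀ {u v I Z} → CompatibleSuffixes u v I Z → corrPoly u v IndicatorOf FibLength I
invariant-indicator {u} {v} {I} inv = indicator-resp (toFib , fromFib) (corrPoly-indicator u v)
  where
  open CompatibleSuffixes inv
  toFib : ∀ e → Overlap u v e → FibLength I e
  toFib e (s , suf , c , len) with i , idx , len′ , _ ← lengths s suf (length≡suc⇒≢[] len) c =
    i , idx , trans (sym len′) len
  fromFib : ∀ e → FibLength I e → Overlap u v e
  fromFib e (i , idx , Fi≡) with s , suf , c , len , _ ← witness i idx = s , suf , c , trans len Fi≡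

invariant⇒corrPoly≋ : ∀ {u v I Z P} → CompatibleSuffixes u v I Z → P IndicatorOf FibLength I → corrPoly u v ≋ P
invariant⇒corrPoly≋ inv = indicator-≋ (invariant-indicator inv)

noCompatible⇒corrPoly≋0 : ∀ {u v} → NoCompatibleSuffix u v → corrPoly u v ≋ 0ₚ
noCompatible⇒corrPoly≋0 {u} {v} none =
  indicator-≋ (indicator-resp ((λ { e (s , suf , c , len) → none s suf (length≡suc⇒≢[] len) c }) , λ _ ())
                 (corrPoly-indicator u v))
    indicator-0ₚ

frame : ℕ → Word → Word
frame a c = a ∷ c ++ [ a ]

next : Word → Word
next c = φ c ++ [ 0 ]

φ-frame0 : ∀ c → φ (frame 0 c) ≡ 0 ∷ frame 1 (next c)
φ-frame0 c = cong (λ w → 0 ∷ 1 ∷ w) (trans (φ-++ c [ 0 ]) (sym (++-assoc (φ c) [ 0 ] [ 1 ])))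

φ-frame1 : ∀ c → φ (frame 1 c ++ [ 1 ]) ≡ frame 0 (next c)
φ-frame1 c = cong (0 ∷_) (trans (φ-++ (c ++ [ 1 ]) [ 1 ]) (cong (_++ [ 0 ]) (φ-++ c [ 1 ])))

φ∷ʳ1-compatible-suffix⁻ : ∀ {u v s'} → Binary u → Binary v →
  s' IsSuffixOf φ (u ++ [ 1 ]) → s' ≢ [] → Compatible s' (φ (v ++ [ 1 ])) →
  ∃[ s ] s IsSuffixOf u × Compatible s v × φ (s ++ [ 1 ]) ≡ s'
φ∷ʳ1-compatible-suffix⁻ {s' = []} _ _ _ s'≢[] _ = ⊥-elim (s'≢[] refl)
φ∷ʳ1-compatible-suffix⁻ {u} {v} {c ∷ r} bu bv suf _ cmp
  with refl ← proj₁ (subst (Compatible (c ∷ r)) (proj₂ (φ-∷ʳ v 1)) cmp)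
  with x , x⊑u1 , φx ← suffix-φ⁻ (u ++ [ 1 ]) suf
  with s , refl , s⊑u ← suffix-∷ʳ⁻ u 1 x⊑u1 (φ≡∷⇒≢[] φx) =
  s , s⊑u , φ-∷ʳ1-compatible⁻ (suffix-binary s⊑u bu) bv (subst (λ w → Compatible w _) (sym φx) cmp) , φx

frame1-compatible-suffix⁻ : ∀ {c d s'} → Binary c → Binary d →
  s' IsSuffixOf frame 1 (next c) → s' ≢ [] → Compatible s' (frame 1 (next d)) →
  ∃[ x ] x IsSuffixOf frame 0 c × Compatible x (frame 0 d) × φ x ≡ 0 ∷ s'
frame1-compatible-suffix⁻ {s' = []} _ _ _ s'≢[] _ = ⊥-elim (s'≢[] refl)
frame1-compatible-suffix⁻ {c} {d} {.1 ∷ r} bc bd suf _ (refl , cmp)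
  with x , x⊑u , φx ← suffix-φ⁻ (frame 0 c)
         (suffix-φ-1 (frame 0 c) (subst (1 ∷ r IsSuffixOf_) (sym (φ-frame0 c)) (suffix-∷ 0 suf)))
  with x₀ , refl , x₀⊑ ← suffix-∷ʳ⁻ (0 ∷ c) 0 x⊑u (φ≡∷⇒≢[] φx) =
  x₀ ++ [ 0 ] , x⊑u , φ-∷ʳ0-compatible⁻ (suffix-binary x₀⊑ (z≤n ∷ bc)) (z≤n ∷ bd) images , φx
  where
  images : Compatible (φ (x₀ ++ [ 0 ])) (φ (frame 0 d))
  images = subst₂ Compatible (sym φx) (sym (φ-frame0 d)) (refl , refl , cmp)

φ∷ʳ1-invariant : ∀ {u v n b} → Binary u → Binary v →
  OddInvariant u v n b → EvenInvariant (φ (u ++ [ 1 ])) (φ (v ++ [ 1 ])) n b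
φ∷ʳ1-invariant {u} {v} {n} {b} bu bv inv = record { lengths = lengths′ ; witness = witness′ }
  where
  open CompatibleSuffixes inv
  lengths′ : ∀ s' → s' IsSuffixOf φ (u ++ [ 1 ]) → s' ≢ [] → Compatible s' (φ (v ++ [ 1 ])) →
             ∃[ i ] OddIdx n b i × length s' ≡ F i × zeros s' ≡ suc (F (pred i))
  lengths′ s' suf s'≢[] cmp with φ∷ʳ1-compatible-suffix⁻ bu bv suf s'≢[] cmp
  ... | [] , _ , _ , refl = 1 , inj₁ (0 , z≤n , refl) , refl , refl
  ... | s@(_ ∷ _) , s⊑u , s~v , refl
    with i , idx , len , zs ← lengths s s⊑u (λ ()) s~v
    with i₀ , refl ← evenIdx-nonzero idx =
    suc i , evenIdx-shift idx , φ∷ʳ1-shape s i₀ len zs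
  witness′ : ∀ i → OddIdx n b i →
             ∃[ s' ] s' IsSuffixOf φ (u ++ [ 1 ]) × Compatible s' (φ (v ++ [ 1 ])) ×
                     length s' ≡ F i × zeros s' ≡ suc (F (pred i))
  witness′ i idx with oddIdx-unshift idx
  ... | inj₁ refl =
    φ [ 1 ] , suffix-φ (suffix-++ʳ [ 1 ] (suffix-[] u)) , φ-∷ʳ1-compatible [] v tt , refl , refl
  ... | inj₂ (i′ , idx′ , refl)
    with s , s⊑u , s~v , len , zs ← witness i′ idx′
    with i₀ , refl ← evenIdx-nonzero idx′ =
    φ (s ++ [ 1 ]) , suffix-φ (suffix-++ʳ [ 1 ] s⊑u) , φ-∷ʳ1-compatible s v s~v , φ∷ʳ1-shape s i₀ len zs

frame0-invariant : ∀ {c d n b} → Binary c → Binary d →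
  EvenInvariant (frame 0 c) (frame 0 d) n b → OddInvariant (frame 1 (next c)) (frame 1 (next d)) (suc n) b
frame0-invariant {c} {d} {n} {b} bc bd inv = record { lengths = lengths′ ; witness = witness′ }
  where
  open CompatibleSuffixes inv
  lengths′ : ∀ s' → s' IsSuffixOf frame 1 (next c) → s' ≢ [] → Compatible s' (frame 1 (next d)) →
             ∃[ i ] EvenIdx (suc n) b i × length s' ≡ F i × suc (zeros s') ≡ F (pred i)
  lengths′ s' suf s'≢[] cmp
    with x , x⊑u , x~v , φx ← frame1-compatible-suffix⁻ bc bd suf s'≢[] cmp
    with i , idx , len , zs ← lengths x x⊑u (φ≡∷⇒≢[] φx) x~v
    with i₀ , refl ← oddIdx-nonzero idx =
    suc i , oddIdx-shift idx , φ-tail-shape x s' i₀ φx len zs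
  witness′ : ∀ i → EvenIdx (suc n) b i →
             ∃[ s' ] s' IsSuffixOf frame 1 (next c) × Compatible s' (frame 1 (next d)) ×
                     length s' ≡ F i × suc (zeros s') ≡ F (pred i)
  witness′ i idx
    with i′ , idx′ , refl ← evenIdx-unshift idx
    with s , s⊑u , s~v , len , zs ← witness i′ idx′
    with i₀ , refl ← oddIdx-nonzero idx′
    with s' , φs ← φ-nonempty s (length≡F⇒≢[] {i = i₀} len) =
    s' , suffix-∷⁻ (subst₂ _IsSuffixOf_ φs (φ-frame0 c) (suffix-φ s⊑u)) ,
    proj₂ (subst₂ Compatible φs (φ-frame0 d) (φ-compatible s (frame 0 d) s~v)) ,
    φ-tail-shape s s' i₀ φs len zs

frame0-noCompatible : ∀ {c v} → Binary c → Binary v →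
  NoCompatibleSuffix (frame 0 c) v → NoCompatibleSuffix (frame 1 (next c)) (φ (v ++ [ 1 ]))
frame0-noCompatible _ _ _ [] _ s'≢[] _ = s'≢[] refl
frame0-noCompatible {c} {v} bc bv none (a ∷ r) suf _ cmp
  with refl ← proj₁ (subst (Compatible (a ∷ r)) (proj₂ (φ-∷ʳ v 1)) cmp)
  with x , x⊑u , φx ← suffix-φ⁻ (frame 0 c) (subst (0 ∷ r IsSuffixOf_) (sym (φ-frame0 c)) (suffix-∷ 0 suf))
  with x₀ , refl , x₀⊑ ← suffix-∷ʳ⁻ (0 ∷ c) 0 x⊑u (φ≡∷⇒≢[] φx) =
  none (x₀ ++ [ 0 ]) x⊑u (φ≡∷⇒≢[] φx)
    (φ-∷ʳ01-compatible⁻ (suffix-binary x₀⊑ (z≤n ∷ bc)) bv (subst (λ w → Compatible w _) (sym φx) cmp))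

φ∷ʳ1-noCompatible : ∀ {u d} → Binary u → Binary d →
  NoCompatibleSuffix u (frame 0 d) → NoCompatibleSuffix (φ (u ++ [ 1 ])) (frame 1 (next d))
φ∷ʳ1-noCompatible _ _ _ [] _ s'≢[] _ = s'≢[] refl
φ∷ʳ1-noCompatible {u} {d} bu bd none (.1 ∷ r) suf _ (refl , cmp)
  with x , x⊑u1 , φx ← suffix-φ⁻ (u ++ [ 1 ]) (suffix-φ-1 (u ++ [ 1 ]) suf)
  with s , refl , s⊑u ← suffix-∷ʳ⁻ u 1 x⊑u1 (φ≡∷⇒≢[] φx) =
  none s s⊑u (λ { refl → case φx of λ () })
    (compatible-sym (frame 0 d) s (φ-∷ʳ01-compatible⁻ (z≤n ∷ bd) (suffix-binary s⊑u bu) images))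
  where
  images : Compatible (φ (frame 0 d)) (φ (s ++ [ 1 ]))
  images = subst₂ Compatible (sym (φ-frame0 d)) (sym φx) (refl , refl , compatible-sym r _ cmp)

-- The minimal forbidden factors

-- oddCentral k = p_{2k+3} and evenCentral k = p_{2k+4} (see f-central), so that
-- oddWord k = M_{2k+3} and evenWord k = M_{2k+4}.
mutual
  oddCentral : ℕ → Word
  oddCentral zero = []
  oddCentral (suc k) = next (evenCentral k)

  evenCentral : ℕ → Word
  evenCentral k = next (oddCentral k)

oddWord : ℕ → Word
oddWord k = frame 1 (oddCentral k)

evenWord : ℕ → Word
evenWord k = frame 0 (evenCentral k)

next-binary : ∀ c → Binary (next c)
next-binary c = ++⁺ (φ-binary c) (z≤n ∷ [])

oddCentral-binary : ∀ k → Binary (oddCentral k)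
oddCentral-binary zero = []
oddCentral-binary (suc k) = next-binary (evenCentral k)

evenCentral-binary : ∀ k → Binary (evenCentral k)
evenCentral-binary k = next-binary (oddCentral k)

oddWord-binary : ∀ k → Binary (oddWord k)
oddWord-binary k = s≤s z≤n ∷ ++⁺ (oddCentral-binary k) (s≤s z≤n ∷ [])

f-φ : ∀ n → f (suc (suc n)) ≡ φ (f (suc n))
f-φ zero = refl
f-φ (suc zero) = refl
f-φ (suc (suc n)) =
  trans (cong₂ _++_ (f-φ (suc n)) (f-φ n)) (sym (φ-++ (f (suc (suc n))) (f (suc n))))

φ-++01 : ∀ c → φ (c ++ 0 ∷ 1 ∷ []) ≡ next c ++ 1 ∷ 0 ∷ []
φ-++01 c = trans (φ-++ c (0 ∷ 1 ∷ [])) (sym (++-assoc (φ c) [ 0 ] (1 ∷ 0 ∷ [])))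

φ-++10 : ∀ c → φ (c ++ 1 ∷ 0 ∷ []) ≡ next c ++ 0 ∷ 1 ∷ []
φ-++10 c = trans (φ-++ c (1 ∷ 0 ∷ [])) (sym (++-assoc (φ c) [ 0 ] (0 ∷ 1 ∷ [])))

f-central : ∀ k → f (3 + 2 * k) ≡ oddCentral k ++ 0 ∷ 1 ∷ [] × f (4 + 2 * k) ≡ evenCentral k ++ 1 ∷ 0 ∷ []
f-central zero = refl , refl
f-central (suc k) = f-odd , trans (f-φ (2 + 2 * suc k)) (trans (cong φ f-odd) (φ-++01 (oddCentral (suc k))))
  where
  f-odd : f (3 + 2 * suc k) ≡ oddCentral (suc k) ++ 0 ∷ 1 ∷ []
  f-odd = trans (cong (λ j → f (3 + j)) (*-suc 2 k))
            (trans (f-φ (3 + 2 * k)) (trans (cong φ (proj₂ (f-central k))) (φ-++10 (evenCentral k))))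

p-from-f : ∀ n c {a b} → f n ≡ c ++ a ∷ b ∷ [] → p n ≡ c
p-from-f n c {a} {b} e = begin
  reverse (drop 2 (reverse (f n)))               ≡⟨ cong (λ w → reverse (drop 2 (reverse w))) e ⟩
  reverse (drop 2 (reverse (c ++ a ∷ b ∷ [])))  ≡⟨ cong (λ w → reverse (drop 2 w)) (reverse-++ c (a ∷ b ∷ [])) ⟩
  reverse (reverse c)                            ≡⟨ reverse-involutive c ⟩
  c                                              ∎
  where open ≡-Reasoning

M-odd : ∀ N → N % 2 ≡ 1 → M N ≡ frame 1 (p N)
M-odd N e = cong (λ r → if r ≡ᵇ 1 then 1 ∷ (p N ++ [ 1 ]) else 0 ∷ (p N ++ [ 0 ])) e

M-even : ∀ N → N % 2 ≡ 0 → M N ≡ frame 0 (p N)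
M-even N e = cong (λ r → if r ≡ᵇ 1 then 1 ∷ (p N ++ [ 1 ]) else 0 ∷ (p N ++ [ 0 ])) e

M-oddWord : ∀ k → M (2 * suc k + 1) ≡ oddWord k
M-oddWord k = trans (M-odd (2 * suc k + 1) parity)
  (cong (frame 1) (trans (cong p index) (p-from-f (3 + 2 * k) (oddCentral k) (proj₁ (f-central k)))))
  where
  index : 2 * suc k + 1 ≡ 3 + 2 * k
  index = trans (+-comm (2 * suc k) 1) (cong suc (*-suc 2 k))
  parity : (2 * suc k + 1) % 2 ≡ 1
  parity = trans (cong (_% 2) (trans (+-comm (2 * suc k) 1) (cong suc (*-comm 2 (suc k))))) ([m+kn]%n≡m%n 1 (suc k) 2)

M-evenWord : ∀ k → M (2 * suc k + 2) ≡ evenWord k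
M-evenWord k = trans (M-even (2 * suc k + 2) parity)
  (cong (frame 0) (trans (cong p index) (p-from-f (4 + 2 * k) (evenCentral k) (proj₂ (f-central k)))))
  where
  index : 2 * suc k + 2 ≡ 4 + 2 * k
  index = trans (+-comm (2 * suc k) 2) (cong (2 +_) (*-suc 2 k))
  parity : (2 * suc k + 2) % 2 ≡ 0
  parity = trans (cong (_% 2) (trans (+-comm (2 * suc k) 2) (cong (2 +_) (*-comm 2 (suc k))))) (m*n%n≡0 (2 + k) 2)

next-head : ∀ c → ∃[ r ] next c ≡ 0 ∷ r
next-head [] = [] , refl
next-head (a ∷ c) with r , φ≡ ← φ-∷ a c = r ++ [ 0 ] , cong (_++ [ 0 ]) φ≡

oddWord-suc-head : ∀ m → ∃[ r ] oddWord (suc m) ≡ 1 ∷ 0 ∷ r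
oddWord-suc-head m with r , e ← next-head (evenCentral m) = r ++ [ 1 ] , cong (λ w → 1 ∷ w ++ [ 1 ]) e

11-not-suffix-oddWord-suc : ∀ m {r} → ¬ (1 ∷ 1 ∷ r) IsSuffixOf oddWord (suc m)
11-not-suffix-oddWord-suc m {r} suf =
  11-not-suffix-φ (evenWord m) (subst (1 ∷ 1 ∷ r IsSuffixOf_) (sym (φ-frame0 (evenCentral m))) (suffix-∷ 0 suf))

11-not-suffix-evenWord : ∀ m {r} → ¬ (1 ∷ 1 ∷ r) IsSuffixOf evenWord m
11-not-suffix-evenWord m {r} suf =
  11-not-suffix-φ (oddWord m ++ [ 1 ]) (subst (1 ∷ 1 ∷ r IsSuffixOf_) (sym (φ-frame1 (oddCentral m))) suf)

oddInvariant⇒evenInvariant : ∀ a b {n bb} →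
  OddInvariant (oddWord a) (oddWord b) n bb → EvenInvariant (evenWord a) (evenWord b) n bb
oddInvariant⇒evenInvariant a b {n} {bb} inv =
  subst₂ (λ x y → EvenInvariant x y n bb) (φ-frame1 (oddCentral a)) (φ-frame1 (oddCentral b))
    (φ∷ʳ1-invariant (oddWord-binary a) (oddWord-binary b) inv)

evenInvariant⇒oddInvariant : ∀ a b {n bb} →
  EvenInvariant (evenWord a) (evenWord b) n bb → OddInvariant (oddWord (suc a)) (oddWord (suc b)) (suc n) bb
evenInvariant⇒oddInvariant a b = frame0-invariant (evenCentral-binary a) (evenCentral-binary b)

suffixes-11 : ∀ {s} → s IsSuffixOf (1 ∷ 1 ∷ []) → s ≢ [] → s ≡ 1 ∷ 1 ∷ [] ⊎ s ≡ [ 1 ]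
suffixes-11 ([] , refl) _ = inj₁ refl
suffixes-11 (_ ∷ [] , refl) _ = inj₂ refl
suffixes-11 (_ ∷ _ ∷ [] , refl) s≢[] = ⊥-elim (s≢[] refl)

evenIdx₁-cases : ∀ {b i} → EvenIdx 1 b i → i ≡ 2 ⊎ (b ≡ true × i ≡ 3)
evenIdx₁-cases (inj₁ (suc zero , _ , _ , refl)) = inj₁ refl
evenIdx₁-cases (inj₁ (suc (suc _) , _ , s≤s () , _))
evenIdx₁-cases (inj₂ top) = inj₂ top

2∈evenIdx₁ : ∀ {b} → EvenIdx 1 b 2
2∈evenIdx₁ = inj₁ (1 , s≤s z≤n , s≤s z≤n , refl)

self-invariant₀ : OddInvariant (oddWord 0) (oddWord 0) 1 true
self-invariant₀ = record { lengths = lengths′ ; witness = witness′ }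
  where
  lengths′ : ∀ s → s IsSuffixOf oddWord 0 → s ≢ [] → Compatible s (oddWord 0) →
             ∃[ i ] EvenIdx 1 true i × length s ≡ F i × suc (zeros s) ≡ F (pred i)
  lengths′ s suf s≢[] _ with suffixes-11 suf s≢[]
  ... | inj₁ refl = 3 , inj₂ (refl , refl) , refl , refl
  ... | inj₂ refl = 2 , 2∈evenIdx₁ , refl , refl
  witness′ : ∀ i → EvenIdx 1 true i →
             ∃[ s ] s IsSuffixOf oddWord 0 × Compatible s (oddWord 0) × length s ≡ F i × suc (zeros s) ≡ F (pred i)
  witness′ i idx with evenIdx₁-cases idx
  ... | inj₁ refl = [ 1 ] , ([ 1 ] , refl) , (refl , tt) , refl , refl
  ... | inj₂ (_ , refl) = 1 ∷ 1 ∷ [] , suffix-refl _ , (refl , refl , tt) , refl , refl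

short-invariant₀ : ∀ m → OddInvariant (oddWord 0) (oddWord (suc m)) 1 false
short-invariant₀ m = record { lengths = lengths′ ; witness = witness′ }
  where
  r = proj₁ (oddWord-suc-head m)
  head≡ = proj₂ (oddWord-suc-head m)
  lengths′ : ∀ s → s IsSuffixOf oddWord 0 → s ≢ [] → Compatible s (oddWord (suc m)) →
             ∃[ i ] EvenIdx 1 false i × length s ≡ F i × suc (zeros s) ≡ F (pred i)
  lengths′ s suf s≢[] cmp with suffixes-11 suf s≢[]
  ... | inj₁ refl with () ← proj₁ (proj₂ (subst (Compatible (1 ∷ 1 ∷ [])) head≡ cmp))
  ... | inj₂ refl = 2 , 2∈evenIdx₁ , refl , refl
  witness′ : ∀ i → EvenIdx 1 false i →
             ∃[ s ] s IsSuffixOf oddWord 0 × Compatible s (oddWord (suc m)) × length s ≡ F i × suc (zeros s) ≡ F (pred i)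
  witness′ i idx with evenIdx₁-cases idx
  ... | inj₁ refl = [ 1 ] , ([ 1 ] , refl) , subst (Compatible [ 1 ]) (sym head≡) (refl , tt) , refl , refl
  ... | inj₂ (() , _)

long-invariant₀ : ∀ m → OddInvariant (oddWord (suc m)) (oddWord 0) 1 false
long-invariant₀ m = record { lengths = lengths′ ; witness = witness′ }
  where
  lengths′ : ∀ s → s IsSuffixOf oddWord (suc m) → s ≢ [] → Compatible s (oddWord 0) →
             ∃[ i ] EvenIdx 1 false i × length s ≡ F i × suc (zeros s) ≡ F (pred i)
  lengths′ [] _ s≢[] _ = ⊥-elim (s≢[] refl)
  lengths′ (.1 ∷ []) _ _ (refl , _) = 2 , 2∈evenIdx₁ , refl , refl
  lengths′ (.1 ∷ .1 ∷ r) suf _ (refl , refl , _) = ⊥-elim (11-not-suffix-oddWord-suc m suf)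
  witness′ : ∀ i → EvenIdx 1 false i →
             ∃[ s ] s IsSuffixOf oddWord (suc m) × Compatible s (oddWord 0) × length s ≡ F i × suc (zeros s) ≡ F (pred i)
  witness′ i idx with evenIdx₁-cases idx
  ... | inj₁ refl = [ 1 ] , (1 ∷ oddCentral (suc m) , refl) , (refl , tt) , refl , refl
  ... | inj₂ (() , _)

self-invariants : ∀ k →
  OddInvariant (oddWord k) (oddWord k) (suc k) true × EvenInvariant (evenWord k) (evenWord k) (suc k) true
self-invariants zero = self-invariant₀ , oddInvariant⇒evenInvariant 0 0 self-invariant₀
self-invariants (suc k) = odd , oddInvariant⇒evenInvariant (suc k) (suc k) odd
  where odd = evenInvariant⇒oddInvariant k k (proj₂ (self-invariants k))

short-invariants : ∀ {k m} → k < m →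
  OddInvariant (oddWord k) (oddWord m) (suc k) false × EvenInvariant (evenWord k) (evenWord m) (suc k) false
short-invariants {zero} {suc m} _ = short-invariant₀ m , oddInvariant⇒evenInvariant 0 (suc m) (short-invariant₀ m)
short-invariants {suc k} {suc m} (s≤s k<m) = odd , oddInvariant⇒evenInvariant (suc k) (suc m) odd
  where odd = evenInvariant⇒oddInvariant k m (proj₂ (short-invariants k<m))

long-invariants : ∀ {k m} → k < m →
  OddInvariant (oddWord m) (oddWord k) (suc k) false × EvenInvariant (evenWord m) (evenWord k) (suc k) false
long-invariants {zero} {suc m} _ = long-invariant₀ m , oddInvariant⇒evenInvariant (suc m) 0 (long-invariant₀ m)
long-invariants {suc k} {suc m} (s≤s k<m) = odd , oddInvariant⇒evenInvariant (suc m) (suc k) odd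
  where odd = evenInvariant⇒oddInvariant m k (proj₂ (long-invariants k<m))

noCompatible-oddWord0-evenWord : ∀ b → NoCompatibleSuffix (oddWord 0) (evenWord b)
noCompatible-oddWord0-evenWord b s suf s≢[] cmp with suffixes-11 suf s≢[]
... | inj₁ refl = case proj₁ cmp of λ ()
... | inj₂ refl = case proj₁ cmp of λ ()

noCompatible-evenWord-oddWord0 : ∀ a → NoCompatibleSuffix (evenWord a) (oddWord 0)
noCompatible-evenWord-oddWord0 a [] _ s≢[] _ = s≢[] refl
noCompatible-evenWord-oddWord0 a (.1 ∷ []) suf _ (refl , _)
  with t , e , _ ← suffix-∷ʳ⁻ (0 ∷ evenCentral a) 0 suf (λ ()) = case ∷ʳ-injectiveʳ [] t e of λ ()
noCompatible-evenWord-oddWord0 a (.1 ∷ .1 ∷ r) suf _ (refl , refl , _) = 11-not-suffix-evenWord a suf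

noCompatible-step-odd : ∀ a b →
  NoCompatibleSuffix (evenWord a) (oddWord b) → NoCompatibleSuffix (oddWord (suc a)) (evenWord b)
noCompatible-step-odd a b none =
  subst (NoCompatibleSuffix (oddWord (suc a))) (φ-frame1 (oddCentral b))
    (frame0-noCompatible (evenCentral-binary a) (oddWord-binary b) none)

noCompatible-step-even : ∀ a b →
  NoCompatibleSuffix (oddWord a) (evenWord b) → NoCompatibleSuffix (evenWord a) (oddWord (suc b))
noCompatible-step-even a b none =
  subst (λ x → NoCompatibleSuffix x (oddWord (suc b))) (φ-frame1 (oddCentral a))
    (φ∷ʳ1-noCompatible (oddWord-binary a) (evenCentral-binary b) none)

mutual
  noCompatible-odd-even : ∀ a b → NoCompatibleSuffix (oddWord a) (evenWord b)
  noCompatible-odd-even zero b = noCompatible-oddWord0-evenWord b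
  noCompatible-odd-even (suc a) b = noCompatible-step-odd a b (noCompatible-even-odd a b)

  noCompatible-even-odd : ∀ a b → NoCompatibleSuffix (evenWord a) (oddWord b)
  noCompatible-even-odd a zero = noCompatible-evenWord-oddWord0 a
  noCompatible-even-odd a (suc b) = noCompatible-step-even a b (noCompatible-odd-even a b)

<+1⇒≤ : ∀ {k n} → k < n + 1 → k ≤ n
<+1⇒≤ {k} {n} k<n+1 = ≤-pred (subst (k <_) (+-comm n 1) k<n+1)

Σ-even-indicator : ∀ n → Σₚ n (λ k → z^ (F (2 * (n ∸ k)) ∸ 1)) IndicatorOf FibLength (EvenIdx n false)
Σ-even-indicator n = indicator-resp (toFib , fromFib) (indicator-Σₚ n (λ k → indicator-z^ _) unique)
  where
  F-pos-even : ∀ {j} → 1 ≤ j → 1 ≤ F (2 * j)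
  F-pos-even 1≤j = F-pos′ (≤-trans (s≤s z≤n) (2≤2* 1≤j))
  unique : ∀ {k k' e} → k < n → k' < n → F (2 * (n ∸ k)) ∸ 1 ≡ e → F (2 * (n ∸ k')) ∸ 1 ≡ e → k ≡ k'
  unique k<n k'<n eq eq' =
    ∸-cancelˡ-≡ (<⇒≤ k<n) (<⇒≤ k'<n)
      (strictlyMonotone⇒injective (λ 1≤a _ → F-even-strict 1≤a) (m<n⇒0<n∸m k<n) (m<n⇒0<n∸m k'<n)
        (∸1-injective (F-pos-even (m<n⇒0<n∸m k<n)) (F-pos-even (m<n⇒0<n∸m k'<n)) (trans eq (sym eq'))))
  toFib : ∀ e → (∃[ k ] k < n × F (2 * (n ∸ k)) ∸ 1 ≡ e) → FibLength (EvenIdx n false) e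
  toFib e (k , k<n , eq) =
    2 * (n ∸ k) , inj₁ (n ∸ k , m<n⇒0<n∸m k<n , m∸n≤m n k , refl) , ∸1≡⇒ (F-pos-even (m<n⇒0<n∸m k<n)) eq
  fromFib : ∀ e → FibLength (EvenIdx n false) e → ∃[ k ] k < n × F (2 * (n ∸ k)) ∸ 1 ≡ e
  fromFib e (_ , inj₁ (j , 1≤j , j≤n , refl) , Fi≡) =
    n ∸ j , ∸-monoʳ-< 1≤j j≤n , trans (cong (λ x → F (2 * x) ∸ 1) (m∸[m∸n]≡n j≤n)) (cong (_∸ 1) Fi≡)

Σ-odd-indicator : ∀ n → Σₚ (n + 1) (λ k → z^ (F (2 * (n ∸ k) + 1) ∸ 1)) IndicatorOf FibLength (OddIdx n false)
Σ-odd-indicator n = indicator-resp (toFib , fromFib) (indicator-Σₚ (n + 1) (λ k → indicator-z^ _) unique)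
  where
  F-pos-odd : ∀ j → 1 ≤ F (2 * j + 1)
  F-pos-odd j = F-pos′ (1≤2*+1 j)
  unique : ∀ {k k' e} → k < n + 1 → k' < n + 1 →
           F (2 * (n ∸ k) + 1) ∸ 1 ≡ e → F (2 * (n ∸ k') + 1) ∸ 1 ≡ e → k ≡ k'
  unique {k} {k'} k<n+1 k'<n+1 eq eq' =
    ∸-cancelˡ-≡ (<+1⇒≤ k<n+1) (<+1⇒≤ k'<n+1)
      (strictlyMonotone⇒injective {P = λ _ → ⊤} (λ _ _ → F-odd-strict) tt tt
        (∸1-injective (F-pos-odd (n ∸ k)) (F-pos-odd (n ∸ k')) (trans eq (sym eq'))))
  toFib : ∀ e → (∃[ k ] k < n + 1 × F (2 * (n ∸ k) + 1) ∸ 1 ≡ e) → FibLength (OddIdx n false) e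
  toFib e (k , _ , eq) = 2 * (n ∸ k) + 1 , inj₁ (n ∸ k , m∸n≤m n k , refl) , ∸1≡⇒ (F-pos-odd (n ∸ k)) eq
  fromFib : ∀ e → FibLength (OddIdx n false) e → ∃[ k ] k < n + 1 × F (2 * (n ∸ k) + 1) ∸ 1 ≡ e
  fromFib e (_ , inj₁ (j , j≤n , refl) , Fi≡) =
    n ∸ j , subst (n ∸ j <_) (sym (+-comm n 1)) (s≤s (m∸n≤m n j)) ,
    trans (cong (λ x → F (2 * x + 1) ∸ 1) (m∸[m∸n]≡n j≤n)) (cong (_∸ 1) Fi≡)

indicator-with-top : ∀ {A : ℕ → Set} {P} t → 1 ≤ t → (∀ {i} → A i → F i < F t) →
  P IndicatorOf FibLength (λ i → A i ⊎ (false ≡ true × i ≡ t)) →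
  z^ (F t ∸ 1) +ₚ P IndicatorOf FibLength (λ i → A i ⊎ (true ≡ true × i ≡ t))
indicator-with-top {A} t 1≤t below ind =
  indicator-resp (toFib , fromFib) (indicator-+ₚ disjoint (indicator-z^ (F t ∸ 1)) ind)
  where
  disjoint : ∀ e → F t ∸ 1 ≡ e → ¬ FibLength (λ i → A i ⊎ (false ≡ true × i ≡ t)) e
  disjoint e eq (i , inj₁ a , Fi≡) = <-irrefl (trans Fi≡ (sym (∸1≡⇒ (F-pos′ 1≤t) eq))) (below a)
  toFib : ∀ e → (F t ∸ 1 ≡ e) ⊎ FibLength (λ i → A i ⊎ (false ≡ true × i ≡ t)) e →
          FibLength (λ i → A i ⊎ (true ≡ true × i ≡ t)) e
  toFib e (inj₁ eq) = t , inj₂ (refl , refl) , ∸1≡⇒ (F-pos′ 1≤t) eq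
  toFib e (inj₂ (i , inj₁ a , Fi≡)) = i , inj₁ a , Fi≡
  fromFib : ∀ e → FibLength (λ i → A i ⊎ (true ≡ true × i ≡ t)) e →
            (F t ∸ 1 ≡ e) ⊎ FibLength (λ i → A i ⊎ (false ≡ true × i ≡ t)) e
  fromFib e (i , inj₁ a , Fi≡) = inj₂ (i , inj₁ a , Fi≡)
  fromFib e (_ , inj₂ (_ , refl) , Fi≡) = inj₁ (cong (_∸ 1) Fi≡)

Σ-even-with-top-indicator : ∀ n →
  z^ (F (2 * n + 1) ∸ 1) +ₚ Σₚ n (λ k → z^ (F (2 * (n ∸ k)) ∸ 1)) IndicatorOf FibLength (EvenIdx n true)
Σ-even-with-top-indicator n = indicator-with-top (2 * n + 1) (1≤2*+1 n) below (Σ-even-indicator n)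
  where
  below : ∀ {i} → (∃[ j ] 1 ≤ j × j ≤ n × i ≡ 2 * j) → F i < F (2 * n + 1)
  below (j , 1≤j , j≤n , refl) = F-strict (2≤2* 1≤j) (≤-<-trans (*-monoʳ-≤ 2 j≤n) (m<m+n (2 * n) z<s))

Σ-odd-with-top-indicator : ∀ n → 1 ≤ n →
  z^ (F (2 * n + 2) ∸ 1) +ₚ Σₚ (n + 1) (λ k → z^ (F (2 * (n ∸ k) + 1) ∸ 1)) IndicatorOf FibLength (OddIdx n true)
Σ-odd-with-top-indicator n 1≤n =
  indicator-with-top (2 * n + 2) (≤-trans (s≤s z≤n) (m≤n+m 2 (2 * n))) below (Σ-odd-indicator n)
  where
  below : ∀ {i} → (∃[ j ] j ≤ n × i ≡ 2 * j + 1) → F i < F (2 * n + 2)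
  below (j , j≤n , refl) =
    F-strict₁ {b = 2 * n + 2} (1≤2*+1 j) (+-mono-≤-< (*-monoʳ-≤ 2 j≤n) (s≤s (s≤s z≤n)))
      (≤-trans (n≤1+n 3) (+-monoˡ-≤ 2 (2≤2* 1≤n)))

theorem5 : (n m : ℕ) → 1 ≤ n → n < m →
    (corrPoly (M (2 * n + 1)) (M (2 * n + 1))
       ≋ z^ (F (2 * n + 1) ∸ 1) +ₚ Σₚ n (λ i → z^ (F (2 * (n ∸ i)) ∸ 1)))
    × (corrPoly (M (2 * n + 2)) (M (2 * n + 2))
       ≋ z^ (F (2 * n + 2) ∸ 1) +ₚ Σₚ (n + 1) (λ i → z^ (F (2 * (n ∸ i) + 1) ∸ 1)))
    × (corrPoly (M (2 * n + 1)) (M (2 * m + 1)) ≋ Σₚ n (λ i → z^ (F (2 * (n ∸ i)) ∸ 1)))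
    × (corrPoly (M (2 * m + 1)) (M (2 * n + 1)) ≋ Σₚ n (λ i → z^ (F (2 * (n ∸ i)) ∸ 1)))
    × (corrPoly (M (2 * n + 2)) (M (2 * m + 2)) ≋ Σₚ (n + 1) (λ i → z^ (F (2 * (n ∸ i) + 1) ∸ 1)))
    × (corrPoly (M (2 * m + 2)) (M (2 * n + 2)) ≋ Σₚ (n + 1) (λ i → z^ (F (2 * (n ∸ i) + 1) ∸ 1)))
    × (corrPoly (M (2 * n + 1)) (M (2 * m + 2)) ≋ 0ₚ)
    × (corrPoly (M (2 * m + 2)) (M (2 * n + 1)) ≋ 0ₚ)
    × (corrPoly (M (2 * m + 1)) (M (2 * n + 2)) ≋ 0ₚ)
    × (corrPoly (M (2 * n + 2)) (M (2 * m + 1)) ≋ 0ₚ)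
theorem5 (suc k) (suc m) _ (s≤s k<m)
  rewrite M-oddWord k | M-evenWord k | M-oddWord m | M-evenWord m =
  invariant⇒corrPoly≋ (proj₁ (self-invariants k)) (Σ-even-with-top-indicator (suc k)) ,
  invariant⇒corrPoly≋ (proj₂ (self-invariants k)) (Σ-odd-with-top-indicator (suc k) (s≤s z≤n)) ,
  invariant⇒corrPoly≋ (proj₁ (short-invariants k<m)) (Σ-even-indicator (suc k)) ,
  invariant⇒corrPoly≋ (proj₁ (long-invariants k<m)) (Σ-even-indicator (suc k)) ,
  invariant⇒corrPoly≋ (proj₂ (short-invariants k<m)) (Σ-odd-indicator (suc k)) ,
  invariant⇒corrPoly≋ (proj₂ (long-invariants k<m)) (Σ-odd-indicator (suc k)) ,
  noCompatible⇒corrPoly≋0 (noCompatible-odd-even k m) ,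
  noCompatible⇒corrPoly≋0 (noCompatible-even-odd m k) ,
  noCompatible⇒corrPoly≋0 (noCompatible-odd-even m k) ,
  noCompatible⇒corrPoly≋0 (noCompatible-even-odd k m)
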